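{- Let $G$ be a finite simple graph, let $\{x,y\}\subseteq V(G)$ be a determining set of $G$, and let $d_1,d_2\in V(G)\setminus\{x,y\}$ be distinct vertices such that some automorphism of $G$ swaps $x$ and $y$ and swaps $d_1$ and $d_2$. If some automorphism $\psi$ of $G$ satisfies $\psi(x)=d_1$, $\psi(d_1)=x$, $\psi(y)=y$, then there is no automorphism $\theta$ of $G$ with $\theta(x)=y,\ \theta(y)=d_1,\ \theta(d_1)=x$, and no automorphism $\theta$ with $\theta(x)=d_1,\ \theta(d_1)=y,\ \theta(y)=x$.
   Context: A set $S\subseteq V(G)$ is a determining set if the only automorphism of $G$ fixing every vertex of $S$ is the identity. -}

module Defs where

open import Level using (0ℓ)
open import Data.Nat using (ℕ)
open import Data.Fin using (Fin)
open import Data.Product using (_×_)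
open import Relation.Binary.PropositionalEquality using (_≡_)
open import Relation.Nullary using (¬_)
open import Function using (_⇔_)
open import Data.Fin.Permutation using (Permutation′; _⟨$⟩ʳ_)
import Data.Sum

record SimpleGraph (n : ℕ) : Set₁ where
  field
    Adj     : Fin n → Fin n → Set
    irrefl  : ∀ v → ¬ Adj v v
    sym     : ∀ {u v} → Adj u v → Adj v u

open SimpleGraph public

record Automorphism {n : ℕ} (G : SimpleGraph n) : Set where
  field
    perm     : Permutation′ n
    preserve : ∀ u v → Adj G u v ⇔ Adj G (perm ⟨$⟩ʳ u) (perm ⟨$⟩ʳ v)

open Automorphism public

_⟨$⟩_ : ∀ {n} {G : SimpleGraph n} → Automorphism G → Fin n → Fin n
σ ⟨$⟩ v = perm σ ⟨$⟩ʳ v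

IsDeterminingSet : ∀ {n} (G : SimpleGraph n) → (Fin n → Set) → Set
IsDeterminingSet {n} G S =
  (σ : Automorphism G) → (∀ v → S v → σ ⟨$⟩ v ≡ v) → ∀ v → σ ⟨$⟩ v ≡ v

Pair : ∀ {n} → Fin n → Fin n → Fin n → Set
Pair x y v = (v ≡ x) Data.Sum.⊎ (v ≡ y)

{-# OPTIONS --safe #-}
-- For θ of either kind, φ ∘ ψ ∘ θ (resp. φ ∘ θ ∘ ψ) fixes x and y but sends
-- d₁ to d₂ ≠ d₁, which is impossible because {x, y} is a determining set.
module Submission where

open import Defs
open import Data.Nat using (ℕ)
open import Data.Fin using (Fin)
open import Data.Product using (_×_; Σ; _,_)
open import Data.Sum using (inj₁; inj₂)
open import Relation.Binary.PropositionalEquality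
  using (_≡_; _≢_; refl; cong; trans) renaming (sym to ≡-sym)
open import Relation.Nullary using (¬_)
open import Function.Construct.Composition using (_⇔-∘_)
open import Data.Fin.Permutation using (_∘ₚ_)

module _ {n : ℕ} {G : SimpleGraph n} where

  infixr 9 _∘ᵃ_

  _∘ᵃ_ : Automorphism G → Automorphism G → Automorphism G
  τ ∘ᵃ σ = record
    { perm     = perm σ ∘ₚ perm τ
    ; preserve = λ u v → preserve τ (σ ⟨$⟩ u) (σ ⟨$⟩ v) ⇔-∘ preserve σ u v
    }

  ∘ᵃ-maps : (τ σ : Automorphism G) {a b c : Fin n} →
            τ ⟨$⟩ b ≡ c → σ ⟨$⟩ a ≡ b → (τ ∘ᵃ σ) ⟨$⟩ a ≡ c
  ∘ᵃ-maps τ σ τb≡c σa≡b = trans (cong (τ ⟨$⟩_) σa≡b) τb≡c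

  fixes-determining-pair⇒fixes-all : {x y : Fin n} →
    IsDeterminingSet G (Pair x y) → (σ : Automorphism G) →
    σ ⟨$⟩ x ≡ x → σ ⟨$⟩ y ≡ y → ∀ v → σ ⟨$⟩ v ≡ v
  fixes-determining-pair⇒fixes-all det σ σx≡x σy≡y = det σ fixesPair
    where
    fixesPair : ∀ v → Pair _ _ v → σ ⟨$⟩ v ≡ v
    fixesPair v (inj₁ refl) = σx≡x
    fixesPair v (inj₂ refl) = σy≡y

proposition6 : {n : ℕ} (G : SimpleGraph n) (x y d₁ d₂ : Fin n) →
    IsDeterminingSet G (Pair x y) →
    d₁ ≢ x → d₁ ≢ y → d₂ ≢ x → d₂ ≢ y → d₁ ≢ d₂ →
    (Σ (Automorphism G) λ φ →
      (φ ⟨$⟩ x ≡ y) × (φ ⟨$⟩ y ≡ x) × (φ ⟨$⟩ d₁ ≡ d₂) × (φ ⟨$⟩ d₂ ≡ d₁)) →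
    (Σ (Automorphism G) λ ψ →
      (ψ ⟨$⟩ x ≡ d₁) × (ψ ⟨$⟩ d₁ ≡ x) × (ψ ⟨$⟩ y ≡ y)) →
    (¬ (Σ (Automorphism G) λ θ →
          (θ ⟨$⟩ x ≡ y) × (θ ⟨$⟩ y ≡ d₁) × (θ ⟨$⟩ d₁ ≡ x)))
    × (¬ (Σ (Automorphism G) λ θ →
          (θ ⟨$⟩ x ≡ d₁) × (θ ⟨$⟩ d₁ ≡ y) × (θ ⟨$⟩ y ≡ x)))
proposition6 G x y d₁ d₂ det _ _ _ _ d₁≢d₂
  (φ , φx≡y , φy≡x , φd₁≡d₂ , _) (ψ , ψx≡d₁ , ψd₁≡x , ψy≡y) =
  no-cycle-x-y-d₁ , no-cycle-x-d₁-y
  where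
  no-pair-fixer-moves-d₁ : (ρ : Automorphism G) →
    ρ ⟨$⟩ x ≡ x → ρ ⟨$⟩ y ≡ y → ρ ⟨$⟩ d₁ ≢ d₂
  no-pair-fixer-moves-d₁ ρ ρx≡x ρy≡y ρd₁≡d₂ =
    d₁≢d₂ (trans (≡-sym (fixes-determining-pair⇒fixes-all det ρ ρx≡x ρy≡y d₁)) ρd₁≡d₂)

  no-cycle-x-y-d₁ : ¬ (Σ (Automorphism G) λ θ →
    (θ ⟨$⟩ x ≡ y) × (θ ⟨$⟩ y ≡ d₁) × (θ ⟨$⟩ d₁ ≡ x))
  no-cycle-x-y-d₁ (θ , θx≡y , θy≡d₁ , θd₁≡x) = no-pair-fixer-moves-d₁ (φ ∘ᵃ ψ ∘ᵃ θ)
    (∘ᵃ-maps φ (ψ ∘ᵃ θ) φy≡x (∘ᵃ-maps ψ θ ψy≡y θx≡y))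
    (∘ᵃ-maps φ (ψ ∘ᵃ θ) φx≡y (∘ᵃ-maps ψ θ ψd₁≡x θy≡d₁))
    (∘ᵃ-maps φ (ψ ∘ᵃ θ) φd₁≡d₂ (∘ᵃ-maps ψ θ ψx≡d₁ θd₁≡x))

  no-cycle-x-d₁-y : ¬ (Σ (Automorphism G) λ θ →
    (θ ⟨$⟩ x ≡ d₁) × (θ ⟨$⟩ d₁ ≡ y) × (θ ⟨$⟩ y ≡ x))
  no-cycle-x-d₁-y (θ , θx≡d₁ , θd₁≡y , θy≡x) = no-pair-fixer-moves-d₁ (φ ∘ᵃ θ ∘ᵃ ψ)
    (∘ᵃ-maps φ (θ ∘ᵃ ψ) φy≡x (∘ᵃ-maps θ ψ θd₁≡y ψx≡d₁))
    (∘ᵃ-maps φ (θ ∘ᵃ ψ) φx≡y (∘ᵃ-maps θ ψ θy≡x ψy≡y))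
    (∘ᵃ-maps φ (θ ∘ᵃ ψ) φd₁≡d₂ (∘ᵃ-maps θ ψ θx≡d₁ ψd₁≡x))
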